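{- Let $(X,\nabla)$ be a regular skew two-graph. Let $R_0,R_1,R_2,R_3$ be the trivial relations on $X^3$ and let \[ R_4=\{(x,y,z)\in X^3: (xyz)\in\nabla\},\qquad R_5=\{(x,y,z)\in X^3: (xyz)\in\mathcal C_3\setminus\nabla\}. \] Then $(X,\{R_i\}_{i=0}^5)$ is a skew-symmetric association scheme on triples whose intersection numbers satisfy $p_{444}^4=p_{445}^5=p_{455}^4=p_{555}^5=0$.
   Context: $X$ is a finite set, $\mathcal C_3$ is the set of $3$-cycles in the symmetric group on $X$; $(xyz)$ denotes the $3$-cycle $x\mapsto y\mapsto z\mapsto x$ (so $x,y,z$ are distinct). A skew two-graph is a pair $(X,\nabla)$ with $\nabla\subseteq\mathcal C_3$ such that (S1) for every $\tau\in\mathcal C_3$ exactly one of $\tau,\tau^{ -1}$ is in $\nabla$ and (S2) for every $4$-subset $\{x,y,z,w\}\subseteq X$, $\nabla$ contains an even number of $(xyz),(xwy),(xzw),(ywz)$; it is regular if the number of $z$ with $(xyz)\in\nabla$ is the same for all ordered pairs of distinct $x,y$. The trivial relations are $R_0=\{(x,x,x)\}$, $R_1=\{(x,y,y):x\ne y\}$, $R_2=\{(x,y,x):x\neq y\}$, $R_3=\{(x,x,y):x\neq y\}$. For $\sigma\in S_3$ and $R\subseteq X^3$, $\sigma(R)=\{(y_{\sigma(1)},y_{\sigma(2)},y_{\sigma(3)}):(y_1,y_2,y_3)\in R\}$. A partition $\{R_0,\dots,R_m\}$ of $X^3$ is an association scheme on triples (AST) if: (I) $R_0,\dots,R_3$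 are the trivial relations; (II) for each $i$ and $\sigma\in S_3$, $\sigma(R_i)=R_j$ for some $j$; (III) for distinct $y,z$ and each $i$, $|\{x:(x,y,z)\in R_i\}|$ depends only on $i$; (IV) for all $i,j,k,\ell$ and $(x,y,z)\in R_\ell$, the number $p_{ijk}^\ell=|\{w\in X:(w,y,z)\in R_i,(x,w,z)\in R_j,(x,y,w)\in R_k\}|$ depends only on $i,j,k,\ell$. An AST with $m=5$ is skew-symmetric if (SS1) $R_4,R_5$ are invariant under the permutation $(123)\in S_3$ and (SS2) $\sigma(R_4)\cap R_4=\sigma(R_5)\cap R_5=\emptyset$ for $\sigma=(12)$. -}

module Defs where

open import Data.Nat using (ℕ; zero; suc; _+_)
open import Data.Fin using (Fin; zero; suc) renaming (_≟_ to _≟F_)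
open import Data.Fin.Permutation using (Permutation′; _⟨$⟩ʳ_)
open import Data.Bool using (Bool; true; false; not; _xor_; if_then_else_)
open import Data.Product using (Σ; ∃; _×_; _,_)
open import Relation.Binary.PropositionalEquality using (_≡_; _≢_)
open import Relation.Nullary using (¬_; yes; no; does)

_⇔_ : Set → Set → Set
A ⇔ B = (A → B) × (B → A)

count : ∀ {n} → (Fin n → Bool) → ℕ
count {zero}  P = 0
count {suc n} P = (if P zero then 1 else 0) + count (λ i → P (suc i))

Distinct : ∀ {n} → Fin n → Fin n → Fin n → Set
Distinct x y z = (x ≢ y) × (y ≢ z) × (x ≢ z)

distinct? : ∀ {n} → Fin n → Fin n → Fin n → Bool
distinct? x y z with x ≟F y | y ≟F z | x ≟F z
... | no _ | no _ | no _ = true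
... | _    | _    | _    = false

-- A 3-cycle (xyz) (x,y,z distinct) is identified with the ordered triple
-- (x,y,z) up to cyclic rotation: (xyz) = (yzx) = (zxy).  A set ∇ of
-- 3-cycles is thus a Boolean predicate `nabla` on ordered triples that is
-- rotation invariant on distinct triples (values on non-distinct triples
-- are irrelevant).  (xyz)⁻¹ = (xzy).

record SkewTwoGraph (n : ℕ) : Set where
  field
    nabla : Fin n → Fin n → Fin n → Bool
    -- well-definedness on 3-cycles
    rotation : ∀ x y z → Distinct x y z → nabla x y z ≡ nabla y z x
    S1 : ∀ x y z → Distinct x y z → nabla x z y ≡ not (nabla x y z)
    S2 : ∀ x y z w → Distinct x y z → w ≢ x → w ≢ y → w ≢ z →
         (nabla x y z xor nabla x w y xor nabla x z w xor nabla y w z) ≡ false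

open SkewTwoGraph public

inNabla : ∀ {n} → SkewTwoGraph n → Fin n → Fin n → Fin n → Bool
inNabla G x y z = if distinct? x y z then nabla G x y z else false

Regular : ∀ {n} → SkewTwoGraph n → Set
Regular {n} G = Σ ℕ λ k → ∀ (x y : Fin n) → x ≢ y → count (λ z → inNabla G x y z) ≡ k

-- Relations on X³ given as a partition {R_0,…,R_m}, i.e. a labelling
-- R : X³ → Fin (suc m); R_i = { t | R t ≡ i }.

Triple : ℕ → Set
Triple n = Fin n × Fin n × Fin n

coord : ∀ {n} → Triple n → Fin 3 → Fin n
coord (a , b , c) zero = a
coord (a , b , c) (suc zero) = b
coord (a , b , c) (suc (suc zero)) = c

act : ∀ {n} → (Fin 3 → Fin 3) → Triple n → Triple n
act σ t = coord t (σ zero) , coord t (σ (suc zero)) , coord t (σ (suc (suc zero)))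

InImage : ∀ {n m} → (Fin 3 → Fin 3) → (Triple n → Fin (suc m)) → Fin (suc m) → Triple n → Set
InImage σ R i u = Σ _ λ t → (R t ≡ i) × (u ≡ act σ t)

-- the permutations (12) and (123) of {1,2,3} (here {0,1,2})
σ12 : Fin 3 → Fin 3
σ12 zero = suc zero
σ12 (suc zero) = zero
σ12 (suc (suc zero)) = suc (suc zero)

σ123 : Fin 3 → Fin 3
σ123 zero = suc zero
σ123 (suc zero) = suc (suc zero)
σ123 (suc (suc zero)) = zero

r0 r1 r2 r3 r4 r5 : ∀ {m} → Fin (6 + m)
r0 = zero
r1 = suc zero
r2 = suc (suc zero)
r3 = suc (suc (suc zero))
r4 = suc (suc (suc (suc zero)))
r5 = suc (suc (suc (suc (suc zero))))

isLabel : ∀ {n m} → (Triple n → Fin (suc m)) → Fin (suc m) → Triple n → Bool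
isLabel R i t = does (R t ≟F i)

pCount : ∀ {n m} → (Triple n → Fin (suc m)) → (i j k : Fin (suc m)) → Triple n → ℕ
pCount R i j k (x , y , z) =
  count (λ w → isLabel R i (w , y , z) Data.Bool.∧ isLabel R j (x , w , z)
                 Data.Bool.∧ isLabel R k (x , y , w))

record IsAST (n m : ℕ) (R : Triple n → Fin (6 + m)) : Set where
  field
    I0 : ∀ x y z → (R (x , y , z) ≡ r0) ⇔ ((x ≡ y) × (y ≡ z))
    I1 : ∀ x y z → (R (x , y , z) ≡ r1) ⇔ ((x ≢ y) × (y ≡ z))
    I2 : ∀ x y z → (R (x , y , z) ≡ r2) ⇔ ((x ≢ y) × (z ≡ x))
    I3 : ∀ x y z → (R (x , y , z) ≡ r3) ⇔ ((x ≡ y) × (y ≢ z))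
    II : ∀ (i : Fin (6 + m)) (σ : Permutation′ 3) → Σ (Fin (6 + m)) λ j →
         ∀ u → InImage (σ ⟨$⟩ʳ_) R i u ⇔ (R u ≡ j)
    III : ∀ (i : Fin (6 + m)) → Σ ℕ λ a → ∀ (y z : Fin n) → y ≢ z →
          count (λ x → isLabel R i (x , y , z)) ≡ a
    IV : ∀ (i j k l : Fin (6 + m)) → Σ ℕ λ p → ∀ t → R t ≡ l → pCount R i j k t ≡ p

record IsSkewSymmetricAST (n : ℕ) (R : Triple n → Fin 6) : Set where
  field
    isAST : IsAST n 0 R
    SS1-4 : ∀ u → InImage σ123 R r4 u ⇔ (R u ≡ r4)
    SS1-5 : ∀ u → InImage σ123 R r5 u ⇔ (R u ≡ r5)
    SS2-4 : ∀ u → ¬ (InImage σ12 R r4 u × (R u ≡ r4))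
    SS2-5 : ∀ u → ¬ (InImage σ12 R r5 u × (R u ≡ r5))

schemeOf : ∀ {n} → SkewTwoGraph n → Triple n → Fin 6
schemeOf G (x , y , z) with x ≟F y | y ≟F z | x ≟F z
... | yes _ | yes _ | _     = r0
... | no _  | yes _ | _     = r1
... | no _  | no _  | yes _ = r2
... | yes _ | no _  | _     = r3
... | no _  | no _  | no _  = if nabla G x y z then r4 else r5

{-# OPTIONS --safe #-}
-- Every triple has one of six shapes, (x,x,x), (x,y,y), (x,y,x), (x,x,y) or a 3-cycle whose
-- orientation is read off ∇, and these are the six relations. Permuting coordinates permutes
-- the shapes, a transposition reversing a 3-cycle and hence, by (S1), exchanging R₄ and R₅; as
-- S₃ is generated by transpositions this gives (II) and skew-symmetry. For (III) and (IV), the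
-- relations seen from a point w off a triple t are determined by the orientations of the
-- 3-cycles that w forms with the sides of t. Regularity fixes how many w have each single
-- orientation, and by (S2) the third orientation is the xor of the other two and of the
-- orientation of t. With |a| + |b| = |a xor b| + 2|a ∧ b| this fixes the number of w with every
-- orientation pattern; a pattern of the wrong parity never occurs, which gives the four
-- vanishing intersection numbers.
module Submission where

open import Defs
open import Data.Bool using (Bool; true; false; not; _∧_; _xor_; if_then_else_)
open import Data.Bool.Properties
  using ( ∧-assoc; ∧-comm; ∧-identityʳ; ∧-zeroʳ; xor-assoc; xor-same; xor-identityʳ
        ; not-involutive; not-¬; ¬-not )
open import Data.Fin using (Fin; zero; suc) renaming (_≟_ to _≟F_)
open import Data.Fin.Patterns using (0F; 1F; 2F; 3F; 4F; 5F)
open import Data.Fin.Permutation as Perm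
  using (Permutation′; _⟨$⟩ʳ_; _⟨$⟩ˡ_; _∘ₚ_; inverseˡ; transpose)
open import Data.Fin.Permutation.Transposition.List
  using (TranspositionList; eval; decompose; eval-decompose)
open import Data.Fin.Properties using (any?)
open import Data.List using (List; []; _∷_; length)
open import Data.List.Relation.Binary.Pointwise using (Pointwise; []; _∷_)
open import Data.List.Relation.Unary.All using (All; []; _∷_)
open import Data.List.Relation.Unary.AllPairs using (AllPairs; []; _∷_)
open import Data.Nat using (ℕ; zero; suc; _+_)
open import Data.Nat.Properties
  using ( +-identityʳ; +-suc; +-cancelˡ-≡; *-cancelˡ-≡
        ; +-0-commutativeMonoid; +-commutativeSemigroup )
open import Data.Product using (Σ; ∃; _×_; _,_; proj₁; proj₂)
open import Function using (_∘_; _∘′_; const)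
open import Relation.Binary.PropositionalEquality
open import Relation.Nullary using (¬_; yes; no; does)
open import Relation.Nullary.Decidable using (dec-false)
open import Relation.Nullary.Negation using (contradiction)
open import Algebra.Properties.CommutativeMonoid.Sum +-0-commutativeMonoid
  using (sum; ∑-distrib-+; sum-cong-≗)
open import Algebra.Properties.CommutativeSemigroup +-commutativeSemigroup using (x∙yz≈y∙xz)

open ≡-Reasoning

private
  variable
    n : ℕ
    u v : Fin n
    P Q Q′ : Fin n → Bool
    xs : List (Fin n)

-- Counting

bit : Bool → ℕ
bit b = if b then 1 else 0

infixr 7 _∩_

_∩_ : (Fin n → Bool) → (Fin n → Bool) → Fin n → Bool
(P ∩ Q) w = P w ∧ Q w

∁ : (Fin n → Bool) → Fin n → Bool
∁ P w = not (P w)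

count-cong : P ≗ Q → count P ≡ count Q
count-cong {zero}  P≗Q = refl
count-cong {suc n} P≗Q = cong₂ _+_ (cong bit (P≗Q zero)) (count-cong (P≗Q ∘ suc))

count-const : ∀ q → count {n} (const q) ≡ (if q then n else 0)
count-const {zero}  true  = refl
count-const {zero}  false = refl
count-const {suc n} true  = cong suc (count-const {n} true)
count-const {suc n} false = count-const {n} false

count-zero : (∀ w → P w ≡ false) → count P ≡ 0
count-zero {n} P≡false = trans (count-cong P≡false) (count-const {n} false)

count≡sum : ∀ (P : Fin n → Bool) → count P ≡ sum (bit ∘ P)
count≡sum {zero}  P = refl
count≡sum {suc n} P = cong (bit (P zero) +_) (count≡sum (P ∘ suc))

count-+ : (∀ w → bit (P w) ≡ bit (Q w) + bit (Q′ w)) → count P ≡ count Q + count Q′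
count-+ {P = P} {Q = Q} {Q′ = Q′} split = begin
  count P                            ≡⟨ count≡sum P ⟩
  sum (bit ∘ P)                      ≡⟨ sum-cong-≗ split ⟩
  sum (λ w → bit (Q w) + bit (Q′ w)) ≡⟨ ∑-distrib-+ (bit ∘ Q) (bit ∘ Q′) ⟩
  sum (bit ∘ Q) + sum (bit ∘ Q′)     ≡⟨ cong₂ _+_ (count≡sum Q) (count≡sum Q′) ⟨
  count Q + count Q′                 ∎

count-split : ∀ (D a : Fin n → Bool) → count D ≡ count (D ∩ a) + count (D ∩ ∁ a)
count-split D a = count-+ (λ w → split (D w) (a w))
  where
  split : ∀ d α → bit d ≡ bit (d ∧ α) + bit (d ∧ not α)
  split false _     = refl
  split true  true  = refl
  split true  false = refl

count-by-feature : ∀ (D a : Fin n → Bool) (G : Bool → Fin n → Bool) →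
  count (D ∩ λ w → G (a w) w) ≡ count ((D ∩ a) ∩ G true) + count ((D ∩ ∁ a) ∩ G false)
count-by-feature D a G = count-+ (λ w → split w (D w) (a w))
  where
  split : ∀ w d α → bit (d ∧ G α w) ≡ bit ((d ∧ α) ∧ G true w) + bit ((d ∧ not α) ∧ G false w)
  split w false _     = refl
  split w true  true  = sym (+-identityʳ _)
  split w true  false = refl

count-∩-const-cong : ∀ (D D′ : Fin n → Bool) → count D ≡ count D′ →
  ∀ q → count (D ∩ const q) ≡ count (D′ ∩ const q)
count-∩-const-cong D D′ D≡D′ true = begin
  count (D ∩ const true)  ≡⟨ count-cong (∧-identityʳ ∘ D) ⟩
  count D                 ≡⟨ D≡D′ ⟩
  count D′                ≡⟨ count-cong (∧-identityʳ ∘ D′) ⟨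
  count (D′ ∩ const true) ∎
count-∩-const-cong D D′ _ false =
  trans (count-zero (∧-zeroʳ ∘ D)) (sym (count-zero (∧-zeroʳ ∘ D′)))

count-∁-cong : ∀ (D D′ a a′ : Fin n → Bool) → count D ≡ count D′ →
  count (D ∩ a) ≡ count (D′ ∩ a′) → count (D ∩ ∁ a) ≡ count (D′ ∩ ∁ a′)
count-∁-cong D D′ a a′ D≡D′ Da≡D′a′ = +-cancelˡ-≡ (count (D ∩ a)) _ _ (begin
  count (D ∩ a) + count (D ∩ ∁ a)     ≡⟨ count-split D a ⟨
  count D                             ≡⟨ D≡D′ ⟩
  count D′                            ≡⟨ count-split D′ a′ ⟩
  count (D′ ∩ a′) + count (D′ ∩ ∁ a′) ≡⟨ cong (_+ _) Da≡D′a′ ⟨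
  count (D ∩ a) + count (D′ ∩ ∁ a′)   ∎)

∩-cong-on : ∀ {D : Fin n → Bool} → (∀ w → D w ≡ true → P w ≡ Q w) →
            count (D ∩ P) ≡ count (D ∩ Q)
∩-cong-on {D = D} P≡Q = count-cong on
  where
  on : ∀ w → D w ∧ _ ≡ D w ∧ _
  on w with D w in Dw
  ... | false = refl
  ... | true  = P≡Q w Dw

∩-swap : ∀ (D a b : Fin n → Bool) → (D ∩ a) ∩ b ≗ (D ∩ b) ∩ a
∩-swap D a b w with D w
... | false = refl
... | true  = ∧-comm (a w) (b w)

feature₁-count-cong : ∀ (D D′ a a′ : Fin n → Bool) → count D ≡ count D′ →
  count (D ∩ a) ≡ count (D′ ∩ a′) →
  ∀ (F : Bool → Bool) → count (D ∩ F ∘′ a) ≡ count (D′ ∩ F ∘′ a′)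
feature₁-count-cong D D′ a a′ D≡D′ Da≡D′a′ F = begin
  count (D ∩ F ∘′ a)
    ≡⟨ count-by-feature D a (λ α _ → F α) ⟩
  count ((D ∩ a) ∩ const (F true)) + count ((D ∩ ∁ a) ∩ const (F false))
    ≡⟨ cong₂ _+_ (count-∩-const-cong (D ∩ a) (D′ ∩ a′) Da≡D′a′ (F true))
                 (count-∩-const-cong (D ∩ ∁ a) (D′ ∩ ∁ a′)
                   (count-∁-cong D D′ a a′ D≡D′ Da≡D′a′) (F false)) ⟩
  count ((D′ ∩ a′) ∩ const (F true)) + count ((D′ ∩ ∁ a′) ∩ const (F false))
    ≡⟨ count-by-feature D′ a′ (λ α _ → F α) ⟨
  count (D′ ∩ F ∘′ a′) ∎

feature₂-count-cong : ∀ (D D′ a a′ b b′ : Fin n → Bool) → count D ≡ count D′ →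
  count (D ∩ a) ≡ count (D′ ∩ a′) → count (D ∩ b) ≡ count (D′ ∩ b′) →
  count ((D ∩ a) ∩ b) ≡ count ((D′ ∩ a′) ∩ b′) →
  ∀ (F : Bool → Bool → Bool) →
  count (D ∩ λ w → F (a w) (b w)) ≡ count (D′ ∩ λ w → F (a′ w) (b′ w))
feature₂-count-cong D D′ a a′ b b′ D≡ Da≡ Db≡ Dab≡ F = begin
  count (D ∩ λ w → F (a w) (b w))
    ≡⟨ count-by-feature D a (λ α w → F α (b w)) ⟩
  count ((D ∩ a) ∩ F true ∘′ b) + count ((D ∩ ∁ a) ∩ F false ∘′ b)
    ≡⟨ cong₂ _+_ (feature₁-count-cong (D ∩ a) (D′ ∩ a′) b b′ Da≡ Dab≡ (F true))
                 (feature₁-count-cong (D ∩ ∁ a) (D′ ∩ ∁ a′) b b′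
                   (count-∁-cong D D′ a a′ D≡ Da≡) D¬ab≡ (F false)) ⟩
  count ((D′ ∩ a′) ∩ F true ∘′ b′) + count ((D′ ∩ ∁ a′) ∩ F false ∘′ b′)
    ≡⟨ count-by-feature D′ a′ (λ α w → F α (b′ w)) ⟨
  count (D′ ∩ λ w → F (a′ w) (b′ w)) ∎
  where
  Dba≡ : count ((D ∩ b) ∩ a) ≡ count ((D′ ∩ b′) ∩ a′)
  Dba≡ = begin
    count ((D ∩ b) ∩ a)     ≡⟨ count-cong (∩-swap D b a) ⟩
    count ((D ∩ a) ∩ b)     ≡⟨ Dab≡ ⟩
    count ((D′ ∩ a′) ∩ b′)  ≡⟨ count-cong (∩-swap D′ b′ a′) ⟨
    count ((D′ ∩ b′) ∩ a′)  ∎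
  D¬ab≡ : count ((D ∩ ∁ a) ∩ b) ≡ count ((D′ ∩ ∁ a′) ∩ b′)
  D¬ab≡ = begin
    count ((D ∩ ∁ a) ∩ b)    ≡⟨ count-cong (∩-swap D (∁ a) b) ⟩
    count ((D ∩ b) ∩ ∁ a)    ≡⟨ count-∁-cong (D ∩ b) (D′ ∩ b′) a a′ Db≡ Dba≡ ⟩
    count ((D′ ∩ b′) ∩ ∁ a′) ≡⟨ count-cong (∩-swap D′ (∁ a′) b′) ⟨
    count ((D′ ∩ ∁ a′) ∩ b′) ∎

count-∩-xor : ∀ (D a b : Fin n → Bool) → count (D ∩ a) + count (D ∩ b) ≡
  count (D ∩ λ w → a w xor b w) + (count ((D ∩ a) ∩ b) + count ((D ∩ a) ∩ b))
count-∩-xor D a b = begin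
  count A + count B                 ≡⟨ cong₂ _+_ (count≡sum A) (count≡sum B) ⟩
  sum (bit ∘ A) + sum (bit ∘ B)     ≡⟨ ∑-distrib-+ (bit ∘ A) (bit ∘ B) ⟨
  sum (λ w → bit (A w) + bit (B w)) ≡⟨ sum-cong-≗ (λ w → bit-xor (D w) (a w) (b w)) ⟩
  sum (λ w → bit (X w) + (bit (Y w) + bit (Y w)))
    ≡⟨ ∑-distrib-+ (bit ∘ X) (λ w → bit (Y w) + bit (Y w)) ⟩
  sum (bit ∘ X) + sum (λ w → bit (Y w) + bit (Y w))
    ≡⟨ cong (sum (bit ∘ X) +_) (∑-distrib-+ (bit ∘ Y) (bit ∘ Y)) ⟩
  sum (bit ∘ X) + (sum (bit ∘ Y) + sum (bit ∘ Y))
    ≡⟨ cong₂ _+_ (count≡sum X) (cong₂ _+_ (count≡sum Y) (count≡sum Y)) ⟨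
  count X + (count Y + count Y)     ∎
  where
  A B X Y : Fin _ → Bool
  A = D ∩ a
  B = D ∩ b
  X = D ∩ λ w → a w xor b w
  Y = (D ∩ a) ∩ b
  bit-xor : ∀ d α β → bit (d ∧ α) + bit (d ∧ β) ≡
            bit (d ∧ (α xor β)) + (bit ((d ∧ α) ∧ β) + bit ((d ∧ α) ∧ β))
  bit-xor false _     _     = refl
  bit-xor true  true  true  = refl
  bit-xor true  true  false = refl
  bit-xor true  false true  = refl
  bit-xor true  false false = refl

m+m≡n+n⇒m≡n : ∀ m n → m + m ≡ n + n → m ≡ n
m+m≡n+n⇒m≡n m n m+m≡n+n = *-cancelˡ-≡ m n 2 (begin
  m + (m + 0) ≡⟨ cong (m +_) (+-identityʳ m) ⟩
  m + m       ≡⟨ m+m≡n+n ⟩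
  n + n       ≡⟨ cong (n +_) (+-identityʳ n) ⟨
  n + (n + 0) ∎)

xor-cancelʳ : ∀ x σ → (x xor σ) xor σ ≡ x
xor-cancelʳ x σ = begin
  (x xor σ) xor σ ≡⟨ xor-assoc x σ σ ⟩
  x xor (σ xor σ) ≡⟨ cong (x xor_) (xor-same σ) ⟩
  x xor false     ≡⟨ xor-identityʳ x ⟩
  x               ∎

xor-solve : ∀ α β γ {σ} → α xor (β xor γ) ≡ σ → γ ≡ (α xor β) xor σ
xor-solve α β γ refl = sym (begin
  (α xor β) xor (α xor (β xor γ)) ≡⟨ cong ((α xor β) xor_) (xor-assoc α β γ) ⟨
  (α xor β) xor ((α xor β) xor γ) ≡⟨ xor-assoc (α xor β) (α xor β) γ ⟨
  ((α xor β) xor (α xor β)) xor γ ≡⟨ cong (_xor γ) (xor-same (α xor β)) ⟩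
  γ                               ∎)

xor-false : ∀ {σ κ} → σ xor κ ≡ false → κ ≡ σ
xor-false {false}     κ≡false  = κ≡false
xor-false {true}  {κ} ¬κ≡false = trans (sym (not-involutive κ)) (cong not ¬κ≡false)

xor-of-nots : ∀ α β γ → not γ xor (not β xor not α) ≡ not (α xor (β xor γ))
xor-of-nots true  true  true  = refl
xor-of-nots true  true  false = refl
xor-of-nots true  false true  = refl
xor-of-nots true  false false = refl
xor-of-nots false true  true  = refl
xor-of-nots false true  false = refl
xor-of-nots false false true  = refl
xor-of-nots false false false = refl

-- On D the third feature is determined by the first two, so only the joint counts of a and b
-- matter, and the count of (D ∩ a) ∩ b is recovered from count-∩-xor.
xor-feature₃-count-cong : ∀ (D D′ a a′ b b′ c c′ : Fin n → Bool) σ →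
  (∀ w → D w ≡ true → c w ≡ (a w xor b w) xor σ) →
  (∀ w → D′ w ≡ true → c′ w ≡ (a′ w xor b′ w) xor σ) →
  count D ≡ count D′ → count (D ∩ a) ≡ count (D′ ∩ a′) → count (D ∩ b) ≡ count (D′ ∩ b′) →
  count (D ∩ c) ≡ count (D′ ∩ c′) →
  ∀ (F : Bool → Bool → Bool → Bool) →
  count (D ∩ λ w → F (a w) (b w) (c w)) ≡ count (D′ ∩ λ w → F (a′ w) (b′ w) (c′ w))
xor-feature₃-count-cong D D′ a a′ b b′ c c′ σ c≡ c′≡ D≡ Da≡ Db≡ Dc≡ F = begin
  count (D ∩ λ w → F (a w) (b w) (c w))
    ≡⟨ ∩-cong-on (λ w Dw → cong (F (a w) (b w)) (c≡ w Dw)) ⟩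
  count (D ∩ λ w → F̃ (a w) (b w))
    ≡⟨ feature₂-count-cong D D′ a a′ b b′ D≡ Da≡ Db≡ Dab≡ F̃ ⟩
  count (D′ ∩ λ w → F̃ (a′ w) (b′ w))
    ≡⟨ ∩-cong-on (λ w Dw → cong (F (a′ w) (b′ w)) (c′≡ w Dw)) ⟨
  count (D′ ∩ λ w → F (a′ w) (b′ w) (c′ w)) ∎
  where
  F̃ : Bool → Bool → Bool
  F̃ α β = F α β ((α xor β) xor σ)
  Dxor≡ : count (D ∩ λ w → a w xor b w) ≡ count (D′ ∩ λ w → a′ w xor b′ w)
  Dxor≡ = begin
    count (D ∩ λ w → a w xor b w)
      ≡⟨ ∩-cong-on (λ w Dw → trans (sym (xor-cancelʳ _ σ)) (cong (_xor σ) (sym (c≡ w Dw)))) ⟩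
    count (D ∩ (_xor σ) ∘′ c)
      ≡⟨ feature₁-count-cong D D′ c c′ D≡ Dc≡ (_xor σ) ⟩
    count (D′ ∩ (_xor σ) ∘′ c′)
      ≡⟨ ∩-cong-on (λ w Dw → trans (sym (xor-cancelʳ _ σ)) (cong (_xor σ) (sym (c′≡ w Dw)))) ⟨
    count (D′ ∩ λ w → a′ w xor b′ w) ∎
  Dab≡ : count ((D ∩ a) ∩ b) ≡ count ((D′ ∩ a′) ∩ b′)
  Dab≡ = m+m≡n+n⇒m≡n _ _ (+-cancelˡ-≡ (count (D ∩ λ w → a w xor b w)) _ _ (begin
    _                                 ≡⟨ count-∩-xor D a b ⟨
    count (D ∩ a) + count (D ∩ b)     ≡⟨ cong₂ _+_ Da≡ Db≡ ⟩
    count (D′ ∩ a′) + count (D′ ∩ b′) ≡⟨ count-∩-xor D′ a′ b′ ⟩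
    _                                 ≡⟨ cong (_+ _) Dxor≡ ⟨
    _                                 ∎))

-- Removing finitely many points

outside : List (Fin n) → Fin n → Bool
outside []       w = true
outside (x ∷ xs) w = not (does (w ≟F x)) ∧ outside xs w

outside⁺ : All (v ≢_) xs → outside xs v ≡ true
outside⁺ []                                = refl
outside⁺ {v = w} (_∷_ {x} w≢x w∉xs) rewrite dec-false (w ≟F x) w≢x = outside⁺ w∉xs

outside⁻ : outside xs v ≡ true → All (v ≢_) xs
outside⁻ {xs = []}     _ = []
outside⁻ {xs = x ∷ xs} {w} out with w ≟F x
... | no w≢x = w≢x ∷ outside⁻ out

∩-cong-outside : ∀ (xs : List (Fin n)) → (∀ w → All (w ≢_) xs → P w ≡ Q w) →
                 count (outside xs ∩ P) ≡ count (outside xs ∩ Q)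
∩-cong-outside _ P≡Q = ∩-cong-on (λ w out → P≡Q w (outside⁻ out))

count-remove : ∀ (x : Fin n) P → count P ≡ bit (P x) + count (λ w → not (does (w ≟F x)) ∧ P w)
count-remove {suc n} zero    P = refl
count-remove {suc n} (suc x) P = begin
  bit (P zero) + count (P ∘ suc)
    ≡⟨ cong (bit (P zero) +_) (count-remove x (P ∘ suc)) ⟩
  bit (P zero) + (bit (P (suc x)) + _)
    ≡⟨ x∙yz≈y∙xz (bit (P zero)) (bit (P (suc x))) _ ⟩
  bit (P (suc x)) + (bit (P zero) + _) ∎

count-remove-outside : All (u ≢_) xs →
  count (outside xs ∩ P) ≡ bit (P u) + count (outside (u ∷ xs) ∩ P)
count-remove-outside {u = x} {xs = xs} {P = P} x∉xs = begin
  count (outside xs ∩ P)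
    ≡⟨ count-remove x (outside xs ∩ P) ⟩
  bit (outside xs x ∧ P x) + count (λ w → not (does (w ≟F x)) ∧ (outside xs w ∧ P w))
    ≡⟨ cong₂ _+_ (cong (λ o → bit (o ∧ P x)) (outside⁺ x∉xs))
                 (count-cong (λ w → sym (∧-assoc _ (outside xs w) (P w)))) ⟩
  bit (P x) + count (outside (x ∷ xs) ∩ P) ∎

count-remove₂ : ∀ {x y : Fin n} → x ≢ y → ∀ P →
  count P ≡ bit (P y) + (bit (P x) + count (outside (x ∷ y ∷ []) ∩ P))
count-remove₂ {y = y} x≢y P = trans (count-remove-outside {u = y} {P = P} [])
                                    (cong (bit (P y) +_) (count-remove-outside (x≢y ∷ [])))

outside-size : ∀ {n} {xs : List (Fin n)} → AllPairs _≢_ xs → length xs + count (outside xs) ≡ n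
outside-size {n = n} []                          = count-const {n} true
outside-size {n = n} {xs = x ∷ xs} (x∉xs ∷ uniq) = begin
  suc (length xs + count (outside (x ∷ xs))) ≡⟨ +-suc (length xs) _ ⟨
  length xs + (1 + count (outside (x ∷ xs))) ≡⟨ cong (length xs +_) (begin
    1 + count (outside (x ∷ xs))
      ≡⟨ cong (1 +_) (count-cong (∧-identityʳ ∘ outside (x ∷ xs))) ⟨
    bit true + count (outside (x ∷ xs) ∩ const true)
      ≡⟨ count-remove-outside x∉xs ⟨
    count (outside xs ∩ const true)
      ≡⟨ count-cong (∧-identityʳ ∘ outside xs) ⟩
    count (outside xs) ∎) ⟩
  length xs + count (outside xs)             ≡⟨ outside-size uniq ⟩
  n                                          ∎

outside-count-cong : ∀ (xs xs′ : List (Fin n)) → AllPairs _≢_ xs → AllPairs _≢_ xs′ →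
                     length xs ≡ length xs′ → count (outside xs) ≡ count (outside xs′)
outside-count-cong xs xs′ uniq uniq′ len≡ = +-cancelˡ-≡ (length xs) _ _ (begin
  length xs + count (outside xs)   ≡⟨ outside-size uniq ⟩
  _                                ≡⟨ outside-size uniq′ ⟨
  length xs′ + count (outside xs′) ≡⟨ cong (_+ _) len≡ ⟨
  length xs + count (outside xs′)  ∎)

count-cong-outside : ∀ (xs xs′ : List (Fin n)) {P P′ : Fin n → Bool} →
  AllPairs _≢_ xs → AllPairs _≢_ xs′ → Pointwise (λ u u′ → P u ≡ P′ u′) xs xs′ →
  count (outside xs ∩ P) ≡ count (outside xs′ ∩ P′) → count P ≡ count P′
count-cong-outside [] [] [] [] [] outside≡ = outside≡
count-cong-outside (x ∷ xs) (x′ ∷ xs′) {P} {P′} (x∉xs ∷ uniq) (x′∉xs′ ∷ uniq′) (Px≡ ∷ P≡) outside≡ =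
  count-cong-outside xs xs′ uniq uniq′ P≡ (begin
    count (outside xs ∩ P)                        ≡⟨ count-remove-outside {P = P} x∉xs ⟩
    bit (P x) + count (outside (x ∷ xs) ∩ P)      ≡⟨ cong₂ _+_ (cong bit Px≡) outside≡ ⟩
    bit (P′ x′) + count (outside (x′ ∷ xs′) ∩ P′) ≡⟨ count-remove-outside {P = P′} x′∉xs′ ⟨
    count (outside xs′ ∩ P′)                      ∎)

distinct⇒unique : ∀ {x y z : Fin n} → Distinct x y z → AllPairs _≢_ (x ∷ y ∷ z ∷ [])
distinct⇒unique (x≢y , y≢z , x≢z) = (x≢y ∷ x≢z ∷ []) ∷ (y≢z ∷ []) ∷ [] ∷ []

∧-rotate : ∀ p q r → p ∧ (q ∧ (r ∧ true)) ≡ q ∧ (r ∧ (p ∧ true))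
∧-rotate true  q     r     = refl
∧-rotate false false r     = refl
∧-rotate false true  true  = refl
∧-rotate false true  false = refl

outside-rotate : ∀ (x y z : Fin n) → outside (x ∷ y ∷ z ∷ []) ≗ outside (y ∷ z ∷ x ∷ [])
outside-rotate x y z w =
  ∧-rotate (not (does (w ≟F x))) (not (does (w ≟F y))) (not (does (w ≟F z)))

-- Profiles: values at a few points and, elsewhere, a function of the orientations seen from them

record Profile₁ {A : Set} (τ : Fin n → A) (a₁ a₀ : A) : Set where
  field
    x    : Fin n
    at-x : τ x ≡ a₁
    off  : ∀ w → w ≢ x → τ w ≡ a₀

record Profile₂ {A : Set} (∇ : Fin n → Fin n → Fin n → Bool) (τ : Fin n → A) (a₁ a₂ : A)
                (g : Bool → A) : Set where
  field
    x y  : Fin n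
    x≢y  : x ≢ y
    at-x : τ x ≡ a₁
    at-y : τ y ≡ a₂
    off  : ∀ w → w ≢ x → w ≢ y → τ w ≡ g (∇ x y w)

record Profile₃ {A : Set} (∇ : Fin n → Fin n → Fin n → Bool) (τ : Fin n → A) (s : Bool)
                (a₁ a₂ a₃ : A) (g : Bool → Bool → Bool → A) : Set where
  field
    x y z       : Fin n
    distinct    : Distinct x y z
    orientation : ∇ x y z ≡ s
    at-x        : τ x ≡ a₁
    at-y        : τ y ≡ a₂
    at-z        : τ z ≡ a₃
    off         : ∀ w → w ≢ x → w ≢ y → w ≢ z → τ w ≡ g (∇ y z w) (∇ z x w) (∇ x y w)

profile₁-count : ∀ {A : Set} {τ τ′ : Fin n → A} {a₁ a₀} →
  Profile₁ τ a₁ a₀ → Profile₁ τ′ a₁ a₀ → ∀ (F : A → Bool) → count (F ∘ τ) ≡ count (F ∘ τ′)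
profile₁-count {τ = τ} {τ′} {a₀ = a₀} p p′ F =
  count-cong-outside (p.x ∷ []) (p′.x ∷ []) ([] ∷ []) ([] ∷ [])
    (cong F (trans p.at-x (sym p′.at-x)) ∷ []) (begin
    count (outside (p.x ∷ []) ∩ F ∘ τ)
      ≡⟨ ∩-cong-outside (p.x ∷ []) (λ { w (w≢x ∷ []) → cong F (p.off w w≢x) }) ⟩
    count (outside (p.x ∷ []) ∩ const (F a₀))
      ≡⟨ count-∩-const-cong (outside (p.x ∷ [])) (outside (p′.x ∷ []))
           (outside-count-cong (p.x ∷ []) (p′.x ∷ []) ([] ∷ []) ([] ∷ []) refl) (F a₀) ⟩
    count (outside (p′.x ∷ []) ∩ const (F a₀))
      ≡⟨ ∩-cong-outside (p′.x ∷ []) (λ { w (w≢x ∷ []) → cong F (p′.off w w≢x) }) ⟨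
    count (outside (p′.x ∷ []) ∩ F ∘ τ′) ∎)
  where
  module p  = Profile₁ p
  module p′ = Profile₁ p′

constant-on-relation : ∀ {m} (R : Triple n → Fin m) (F : Triple n → ℕ) (l : Fin m) →
  (∀ {t t′} → R t ≡ l → R t′ ≡ l → F t ≡ F t′) → Σ ℕ λ p → ∀ t → R t ≡ l → F t ≡ p
constant-on-relation R F l F-const
  with any? (λ x → any? (λ y → any? (λ z → R (x , y , z) ≟F l)))
... | yes (x , y , z , Rxyz≡l) = F (x , y , z) , λ t Rt≡l → F-const Rt≡l Rxyz≡l
... | no  empty               = 0 , λ (x , y , z) Rxyz≡l → contradiction (x , y , z , Rxyz≡l) empty

module SkewTwoGraphScheme {n : ℕ} (G : SkewTwoGraph n) where

  private
    variable
      x y z w x′ y′ z′ : Fin n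
      l : Fin 6
      t : Triple n

  R : Triple n → Fin 6
  R = schemeOf G

  ∇ : Fin n → Fin n → Fin n → Bool
  ∇ = nabla G

  ∇label : Bool → Fin 6
  ∇label b = if b then r4 else r5

  -- Indexed by the relation, so that matching two shapes of the same relation leaves only the six
  -- diagonal cases.
  data Shape : Fin 6 → Triple n → Set where
    xxx  : ∀ x → Shape r0 (x , x , x)
    xyy  : x ≢ y → Shape r1 (x , y , y)
    xyx  : x ≢ y → Shape r2 (x , y , x)
    xxy  : x ≢ y → Shape r3 (x , x , y)
    in∇  : Distinct x y z → ∇ x y z ≡ true  → Shape r4 (x , y , z)
    out∇ : Distinct x y z → ∇ x y z ≡ false → Shape r5 (x , y , z)

  shape : ∀ t → Shape (R t) t
  shape (x , y , z) with x ≟F y | y ≟F z | x ≟F z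
  ... | yes refl | yes refl | _        = xxx x
  ... | no x≢y   | yes refl | _        = xyy x≢y
  ... | no x≢y   | no _     | yes refl = xyx x≢y
  ... | yes refl | no y≢z   | _        = xxy y≢z
  ... | no x≢y   | no y≢z   | no x≢z with ∇ x y z in orientation
  ...   | true  = in∇  (x≢y , y≢z , x≢z) orientation
  ...   | false = out∇ (x≢y , y≢z , x≢z) orientation

  shape-of : R t ≡ l → Shape l t
  shape-of {t = t} Rt≡l = subst (λ l → Shape l t) Rt≡l (shape t)

  R-distinct : Distinct x y z → R (x , y , z) ≡ ∇label (∇ x y z)
  R-distinct {x} {y} {z} (x≢y , y≢z , x≢z) with x ≟F y | y ≟F z | x ≟F z
  ... | yes x≡y | _       | _       = contradiction x≡y x≢y
  ... | no _    | yes y≡z | _       = contradiction y≡z y≢z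
  ... | no _    | no _    | yes x≡z = contradiction x≡z x≢z
  ... | no _    | no _    | no _    = refl

  shape-label : Shape l t → R t ≡ l
  shape-label (xxx x) with x ≟F x
  ... | yes _  = refl
  ... | no x≢x = contradiction refl x≢x
  shape-label (xyy {x} {y} x≢y) with x ≟F y | y ≟F y
  ... | yes x≡y | _      = contradiction x≡y x≢y
  ... | no _    | yes _  = refl
  ... | no _    | no y≢y = contradiction refl y≢y
  shape-label (xyx {x} {y} x≢y) with x ≟F y | y ≟F x | x ≟F x
  ... | yes x≡y | _       | _      = contradiction x≡y x≢y
  ... | no _    | yes y≡x | _      = contradiction (sym y≡x) x≢y
  ... | no _    | no _    | yes _  = refl
  ... | no _    | no _    | no x≢x = contradiction refl x≢x
  shape-label (xxy {x} {y} x≢y) with x ≟F x | x ≟F y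
  ... | _      | yes x≡y = contradiction x≡y x≢y
  ... | yes _  | no _    = refl
  ... | no x≢x | no _    = contradiction refl x≢x
  shape-label (in∇ d orientation)  = trans (R-distinct d) (cong ∇label orientation)
  shape-label (out∇ d orientation) = trans (R-distinct d) (cong ∇label orientation)

  R≡r0⇔ : ∀ x y z → (R (x , y , z) ≡ r0) ⇔ ((x ≡ y) × (y ≡ z))
  R≡r0⇔ x y z = (λ e → from (shape-of e)) , λ { (refl , refl) → shape-label (xxx x) }
    where
    from : Shape r0 (x , y , z) → (x ≡ y) × (y ≡ z)
    from (xxx _) = refl , refl

  R≡r1⇔ : ∀ x y z → (R (x , y , z) ≡ r1) ⇔ ((x ≢ y) × (y ≡ z))
  R≡r1⇔ x y z = (λ e → from (shape-of e)) , λ { (x≢y , refl) → shape-label (xyy x≢y) }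
    where
    from : Shape r1 (x , y , z) → (x ≢ y) × (y ≡ z)
    from (xyy x≢y) = x≢y , refl

  R≡r2⇔ : ∀ x y z → (R (x , y , z) ≡ r2) ⇔ ((x ≢ y) × (z ≡ x))
  R≡r2⇔ x y z = (λ e → from (shape-of e)) , λ { (x≢y , refl) → shape-label (xyx x≢y) }
    where
    from : Shape r2 (x , y , z) → (x ≢ y) × (z ≡ x)
    from (xyx x≢y) = x≢y , refl

  R≡r3⇔ : ∀ x y z → (R (x , y , z) ≡ r3) ⇔ ((x ≡ y) × (y ≢ z))
  R≡r3⇔ x y z = (λ e → from (shape-of e)) , λ { (refl , y≢z) → shape-label (xxy y≢z) }
    where
    from : Shape r3 (x , y , z) → (x ≡ y) × (y ≢ z)
    from (xxy y≢z) = refl , y≢z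

  distinct-rotate : Distinct x y z → Distinct y z x
  distinct-rotate (x≢y , y≢z , x≢z) = y≢z , ≢-sym x≢z , ≢-sym x≢y

  distinct-flip : Distinct x y z → Distinct x z y
  distinct-flip (x≢y , y≢z , x≢z) = x≢z , ≢-sym y≢z , x≢y

  distinct-swap : Distinct x y z → Distinct y x z
  distinct-swap (x≢y , y≢z , x≢z) = ≢-sym x≢y , x≢z , y≢z

  ∇-rotate : Distinct x y z → ∇ x y z ≡ ∇ y z x
  ∇-rotate = rotation G _ _ _

  ∇-flip : Distinct x y z → ∇ x z y ≡ not (∇ x y z)
  ∇-flip = S1 G _ _ _

  ∇-swap : Distinct x y z → ∇ y x z ≡ not (∇ x y z)
  ∇-swap d = trans (∇-rotate (distinct-swap d)) (∇-flip d)

  ∇-parity : Distinct x y z → w ≢ x → w ≢ y → w ≢ z →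
             ∇ y z w xor (∇ z x w xor ∇ x y w) ≡ not (∇ x y z)
  ∇-parity {x} {y} {z} {w} d@(x≢y , y≢z , x≢z) w≢x w≢y w≢z = begin
    a xor (b xor c)                         ≡⟨ not-involutive _ ⟨
    not (not (a xor (b xor c)))             ≡⟨ cong not (xor-of-nots a b c) ⟨
    not (not c xor (not b xor not a))       ≡⟨ cong not (cong₂ _xor_ xwy≡ (cong₂ _xor_ xzw≡ ywz≡)) ⟨
    not (∇ x w y xor (∇ x z w xor ∇ y w z)) ≡⟨ cong not (xor-false (S2 G x y z w d w≢x w≢y w≢z)) ⟩
    not (∇ x y z)                           ∎
    where
    a b c : Bool
    a = ∇ y z w
    b = ∇ z x w
    c = ∇ x y w
    xwy≡ : ∇ x w y ≡ not c
    xwy≡ = ∇-flip (x≢y , ≢-sym w≢y , ≢-sym w≢x)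
    xzw≡ : ∇ x z w ≡ not b
    xzw≡ = trans (∇-flip (≢-sym w≢x , w≢z , x≢z))
                 (cong not (sym (∇-rotate (≢-sym x≢z , ≢-sym w≢x , ≢-sym w≢z))))
    ywz≡ : ∇ y w z ≡ not a
    ywz≡ = ∇-flip (y≢z , ≢-sym w≢z , ≢-sym w≢y)

  R-rotate : Distinct x y z → R (x , y , z) ≡ ∇label (∇ y z x)
  R-rotate d = trans (R-distinct d) (cong ∇label (∇-rotate d))

  R-flip : Distinct x y w → R (x , w , y) ≡ ∇label (not (∇ x y w))
  R-flip d = trans (R-distinct (distinct-flip d)) (cong ∇label (∇-flip d))

  inNabla-distinct : Distinct x y z → inNabla G x y z ≡ ∇ x y z
  inNabla-distinct {x} {y} {z} (x≢y , y≢z , x≢z) with x ≟F y | y ≟F z | x ≟F z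
  ... | yes x≡y | _       | _       = contradiction x≡y x≢y
  ... | no _    | yes y≡z | _       = contradiction y≡z y≢z
  ... | no _    | no _    | yes x≡z = contradiction x≡z x≢z
  ... | no _    | no _    | no _    = refl

  inNabla-degenerate : ¬ Distinct x y z → inNabla G x y z ≡ false
  inNabla-degenerate {x} {y} {z} ¬distinct with x ≟F y | y ≟F z | x ≟F z
  ... | yes _  | _      | _      = refl
  ... | no _   | yes _  | _      = refl
  ... | no _   | no _   | yes _  = refl
  ... | no x≢y | no y≢z | no x≢z = contradiction (x≢y , y≢z , x≢z) ¬distinct

  -- The action of S₃

  record Covariant (h : Triple n → Triple n) : Set where
    field
      relabel   : Permutation′ 6
      R-relabel : ∀ t → R (h t) ≡ relabel ⟨$⟩ʳ R t

  open Covariant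

  ≗-covariant : ∀ {h h′} → (∀ t → h t ≡ h′ t) → Covariant h → Covariant h′
  ≗-covariant h≗h′ cov = record
    { relabel   = relabel cov
    ; R-relabel = λ t → trans (cong R (sym (h≗h′ t))) (R-relabel cov t)
    }

  ∘-covariant : ∀ {h h′} → Covariant h → Covariant h′ → Covariant (h ∘ h′)
  ∘-covariant {h′ = h′} cov cov′ = record
    { relabel   = relabel cov′ ∘ₚ relabel cov
    ; R-relabel = λ t → trans (R-relabel cov (h′ t)) (cong (relabel cov ⟨$⟩ʳ_) (R-relabel cov′ t))
    }

  id-covariant : Covariant (λ t → t)
  id-covariant = record { relabel = Perm.id ; R-relabel = λ _ → refl }

  σ23 : Fin 3 → Fin 3
  σ23 0F = 0F
  σ23 1F = 2F
  σ23 2F = 1F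

  swap₁₂-shape : Shape l t → Shape (transpose 1F 2F ∘ₚ transpose 4F 5F ⟨$⟩ʳ l) (act σ12 t)
  swap₁₂-shape (xxx x)    = xxx x
  swap₁₂-shape (xyy x≢y)  = xyx (≢-sym x≢y)
  swap₁₂-shape (xyx x≢y)  = xyy (≢-sym x≢y)
  swap₁₂-shape (xxy x≢y)  = xxy x≢y
  swap₁₂-shape (in∇ d o)  = out∇ (distinct-swap d) (trans (∇-swap d) (cong not o))
  swap₁₂-shape (out∇ d o) = in∇ (distinct-swap d) (trans (∇-swap d) (cong not o))

  swap₂₃-shape : Shape l t → Shape (transpose 2F 3F ∘ₚ transpose 4F 5F ⟨$⟩ʳ l) (act σ23 t)
  swap₂₃-shape (xxx x)    = xxx x
  swap₂₃-shape (xyy x≢y)  = xyy x≢y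
  swap₂₃-shape (xyx x≢y)  = xxy x≢y
  swap₂₃-shape (xxy x≢y)  = xyx x≢y
  swap₂₃-shape (in∇ d o)  = out∇ (distinct-flip d) (trans (∇-flip d) (cong not o))
  swap₂₃-shape (out∇ d o) = in∇ (distinct-flip d) (trans (∇-flip d) (cong not o))

  swap₁₂-covariant : Covariant (act σ12)
  swap₁₂-covariant = record
    { relabel   = transpose 1F 2F ∘ₚ transpose 4F 5F
    ; R-relabel = λ t → shape-label (swap₁₂-shape (shape t))
    }

  swap₂₃-covariant : Covariant (act σ23)
  swap₂₃-covariant = record
    { relabel   = transpose 2F 3F ∘ₚ transpose 4F 5F
    ; R-relabel = λ t → shape-label (swap₂₃-shape (shape t))
    }

  swap₁₃-covariant : Covariant (act σ12 ∘ act σ23 ∘ act σ12)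
  swap₁₃-covariant = ∘-covariant swap₁₂-covariant (∘-covariant swap₂₃-covariant swap₁₂-covariant)

  transpose-covariant : ∀ i j → Covariant (act (transpose i j ⟨$⟩ʳ_))
  transpose-covariant 0F 0F = ≗-covariant (λ { (_ , _ , _) → refl }) id-covariant
  transpose-covariant 1F 1F = ≗-covariant (λ { (_ , _ , _) → refl }) id-covariant
  transpose-covariant 2F 2F = ≗-covariant (λ { (_ , _ , _) → refl }) id-covariant
  transpose-covariant 0F 1F = ≗-covariant (λ { (_ , _ , _) → refl }) swap₁₂-covariant
  transpose-covariant 1F 0F = ≗-covariant (λ { (_ , _ , _) → refl }) swap₁₂-covariant
  transpose-covariant 1F 2F = ≗-covariant (λ { (_ , _ , _) → refl }) swap₂₃-covariant
  transpose-covariant 2F 1F = ≗-covariant (λ { (_ , _ , _) → refl }) swap₂₃-covariant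
  transpose-covariant 0F 2F = ≗-covariant (λ { (_ , _ , _) → refl }) swap₁₃-covariant
  transpose-covariant 2F 0F = ≗-covariant (λ { (_ , _ , _) → refl }) swap₁₃-covariant

  coord-act : ∀ (f : Fin 3 → Fin 3) (t : Triple n) q → coord (act f t) q ≡ coord t (f q)
  coord-act f t 0F = refl
  coord-act f t 1F = refl
  coord-act f t 2F = refl

  act-∘ : ∀ (f g : Fin 3 → Fin 3) (t : Triple n) → act f (act g t) ≡ act (g ∘ f) t
  act-∘ f g t =
    cong₂ _,_ (coord-act g t (f 0F)) (cong₂ _,_ (coord-act g t (f 1F)) (coord-act g t (f 2F)))

  act-cong : ∀ {f g : Fin 3 → Fin 3} → (∀ q → f q ≡ g q) → ∀ (t : Triple n) → act f t ≡ act g t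
  act-cong f≗g t = cong₂ _,_ (cong (coord t) (f≗g 0F))
                             (cong₂ _,_ (cong (coord t) (f≗g 1F)) (cong (coord t) (f≗g 2F)))

  eval-covariant : ∀ (xs : TranspositionList 3) → Covariant (act (eval xs ⟨$⟩ʳ_))
  eval-covariant []             = ≗-covariant (λ { (_ , _ , _) → refl }) id-covariant
  eval-covariant ((i , j) ∷ xs) = ≗-covariant (act-∘ (transpose i j ⟨$⟩ʳ_) (eval xs ⟨$⟩ʳ_))
                                    (∘-covariant (transpose-covariant i j) (eval-covariant xs))

  permutation-covariant : ∀ (π : Permutation′ 3) → Covariant (act (π ⟨$⟩ʳ_))
  permutation-covariant π = ≗-covariant (act-cong (eval-decompose π)) (eval-covariant (decompose π))

  act-surjective : ∀ (π : Permutation′ 3) u → ∃ λ t → act (π ⟨$⟩ʳ_) t ≡ u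
  act-surjective π u@(_ , _ , _) = act (π ⟨$⟩ˡ_) u ,
    trans (act-∘ (π ⟨$⟩ʳ_) (π ⟨$⟩ˡ_) u) (act-cong (λ q → inverseˡ π {q}) u)

  image-covariant : ∀ f (cov : Covariant (act f)) → (∀ u → ∃ λ t → act f t ≡ u) →
    ∀ i u → InImage f R i u ⇔ (R u ≡ relabel cov ⟨$⟩ʳ i)
  image-covariant f cov surjective i u = to , from
    where
    to : InImage f R i u → R u ≡ relabel cov ⟨$⟩ʳ i
    to (t , Rt≡i , refl) = trans (R-relabel cov t) (cong (relabel cov ⟨$⟩ʳ_) Rt≡i)
    relabel-injective : ∀ {l l′} → relabel cov ⟨$⟩ʳ l ≡ relabel cov ⟨$⟩ʳ l′ → l ≡ l′
    relabel-injective e = trans (sym (inverseˡ (relabel cov)))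
                                (trans (cong (relabel cov ⟨$⟩ˡ_) e) (inverseˡ (relabel cov)))
    from : R u ≡ relabel cov ⟨$⟩ʳ i → InImage f R i u
    from Ru≡ with surjective u
    ... | t , refl = t , relabel-injective (trans (sym (R-relabel cov t)) Ru≡) , refl

  rotate-covariant : Covariant (act σ123)
  rotate-covariant =
    ≗-covariant (λ { (_ , _ , _) → refl }) (∘-covariant swap₂₃-covariant swap₁₂-covariant)

  rotate-image : ∀ i u → InImage σ123 R i u ⇔ (R u ≡ relabel rotate-covariant ⟨$⟩ʳ i)
  rotate-image = image-covariant σ123 rotate-covariant (λ { (a , b , c) → (c , a , b) , refl })

  swap-disjoint : ∀ i u → relabel swap₁₂-covariant ⟨$⟩ʳ i ≢ i → ¬ (InImage σ12 R i u × (R u ≡ i))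
  swap-disjoint i u moved (img , Ru≡i) = moved (trans (sym (proj₁ (swap-image i u) img)) Ru≡i)
    where
    swap-image : ∀ i u → InImage σ12 R i u ⇔ (R u ≡ relabel swap₁₂-covariant ⟨$⟩ʳ i)
    swap-image = image-covariant σ12 swap₁₂-covariant (λ { (a , b , c) → (b , a , c) , refl })

  -- The label triples seen from a point

  labels : Triple n → Fin n → Fin 6 × Fin 6 × Fin 6
  labels (x , y , z) w = R (w , y , z) , R (x , w , z) , R (x , y , w)

  ∇labels : Bool → Bool → Bool → Fin 6 × Fin 6 × Fin 6
  ∇labels α β γ = ∇label α , ∇label β , ∇label γ

  triple-≡ : ∀ {α α′ β β′ γ γ′ : Fin 6} → α ≡ α′ → β ≡ β′ → γ ≡ γ′ → (α , β , γ) ≡ (α′ , β′ , γ′)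
  triple-≡ α≡ β≡ γ≡ = cong₂ _,_ α≡ (cong₂ _,_ β≡ γ≡)

  xxx-profile : ∀ x → Profile₁ (labels (x , x , x)) (r0 , r0 , r0) (r1 , r2 , r3)
  xxx-profile x = record
    { x    = x
    ; at-x = triple-≡ (shape-label (xxx x)) (shape-label (xxx x)) (shape-label (xxx x))
    ; off  = λ w w≢x → triple-≡ (shape-label (xyy w≢x)) (shape-label (xyx (≢-sym w≢x)))
                                (shape-label (xxy (≢-sym w≢x)))
    }

  xyy-profile : x ≢ y → Profile₂ ∇ (labels (x , y , y)) (r1 , r3 , r2) (r0 , r1 , r1)
                                 (λ β → r1 , ∇label (not β) , ∇label β)
  xyy-profile {x} {y} x≢y = record
    { x≢y  = x≢y
    ; at-x = triple-≡ (shape-label (xyy x≢y)) (shape-label (xxy x≢y)) (shape-label (xyx x≢y))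
    ; at-y = triple-≡ (shape-label (xxx y)) (shape-label (xyy x≢y)) (shape-label (xyy x≢y))
    ; off  = λ w w≢x w≢y → let d = x≢y , ≢-sym w≢y , ≢-sym w≢x in
               triple-≡ (shape-label (xyy w≢y)) (R-flip d) (R-distinct d)
    }

  xyx-profile : x ≢ y → Profile₂ ∇ (labels (x , y , x)) (r2 , r0 , r2) (r3 , r2 , r1)
                                 (λ β → ∇label (not β) , r2 , ∇label β)
  xyx-profile {x} {y} x≢y = record
    { x≢y  = x≢y
    ; at-x = triple-≡ (shape-label (xyx x≢y)) (shape-label (xxx x)) (shape-label (xyx x≢y))
    ; at-y = triple-≡ (shape-label (xxy (≢-sym x≢y))) (shape-label (xyx x≢y)) (shape-label (xyy x≢y))
    ; off  = λ w w≢x w≢y → let d = x≢y , ≢-sym w≢y , ≢-sym w≢x in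
               triple-≡ (trans (R-rotate (w≢y , ≢-sym x≢y , w≢x)) (cong ∇label (∇-swap d)))
                        (shape-label (xyx (≢-sym w≢x))) (R-distinct d)
    }

  xxy-profile : x ≢ y → Profile₂ ∇ (labels (x , x , y)) (r3 , r3 , r0) (r2 , r1 , r3)
                                 (λ β → ∇label β , ∇label (not β) , r3)
  xxy-profile {x} {y} x≢y = record
    { x≢y  = x≢y
    ; at-x = triple-≡ (shape-label (xxy x≢y)) (shape-label (xxy x≢y)) (shape-label (xxx x))
    ; at-y = triple-≡ (shape-label (xyx (≢-sym x≢y))) (shape-label (xyy x≢y)) (shape-label (xxy x≢y))
    ; off  = λ w w≢x w≢y → triple-≡ (R-rotate (w≢x , x≢y , w≢y)) (R-flip (x≢y , ≢-sym w≢y , ≢-sym w≢x))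
                                    (shape-label (xxy (≢-sym w≢x)))
    }

  cyclic-profile : ∀ {s} → Distinct x y z → ∇ x y z ≡ s →
    Profile₃ ∇ (labels (x , y , z)) s (∇label s , r3 , r2) (r3 , ∇label s , r1) (r2 , r1 , ∇label s)
             ∇labels
  cyclic-profile {x} {y} {z} d@(x≢y , y≢z , x≢z) orientation = record
    { distinct    = d
    ; orientation = orientation
    ; at-x        = triple-≡ Rxyz (shape-label (xxy x≢z)) (shape-label (xyx x≢y))
    ; at-y        = triple-≡ (shape-label (xxy y≢z)) Rxyz (shape-label (xyy x≢y))
    ; at-z        = triple-≡ (shape-label (xyx (≢-sym y≢z))) (shape-label (xyy x≢z)) Rxyz
    ; off         = λ w w≢x w≢y w≢z →
        triple-≡ (R-rotate (w≢y , y≢z , w≢z))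
                 (trans (R-distinct (≢-sym w≢x , w≢z , x≢z))
                        (cong ∇label (sym (∇-rotate (≢-sym x≢z , ≢-sym w≢x , ≢-sym w≢z)))))
                 (R-distinct (x≢y , ≢-sym w≢y , ≢-sym w≢x))
    }
    where
    Rxyz : R (x , y , z) ≡ ∇label _
    Rxyz = trans (R-distinct d) (cong ∇label orientation)

  column-profile : y ≢ z → Profile₂ ∇ (λ x → R (x , y , z)) r3 r2 ∇label
  column-profile y≢z = record
    { x≢y  = y≢z
    ; at-x = shape-label (xxy y≢z)
    ; at-y = shape-label (xyx (≢-sym y≢z))
    ; off  = λ w w≢y w≢z → R-rotate (w≢y , y≢z , w≢z)
    }

  profile₃-count-zero : ∀ {A : Set} {τ : Fin n → A} {s a₁ a₂ a₃ g} → Profile₃ ∇ τ s a₁ a₂ a₃ g →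
    ∀ (F : A → Bool) → F a₁ ≡ false → F a₂ ≡ false → F a₃ ≡ false →
    (∀ α β γ → α xor (β xor γ) ≡ not s → F (g α β γ) ≡ false) → count (F ∘ τ) ≡ 0
  profile₃-count-zero {τ = τ} p F Fa₁ Fa₂ Fa₃ Fg = count-zero vanishes
    where
    module p = Profile₃ p
    vanishes : ∀ w → F (τ w) ≡ false
    vanishes w with w ≟F p.x | w ≟F p.y | w ≟F p.z
    ... | yes refl | _        | _        = trans (cong F p.at-x) Fa₁
    ... | no _     | yes refl | _        = trans (cong F p.at-y) Fa₂
    ... | no _     | no _     | yes refl = trans (cong F p.at-z) Fa₃
    ... | no w≢x   | no w≢y   | no w≢z   = trans (cong F (p.off w w≢x w≢y w≢z))
      (Fg _ _ _ (trans (∇-parity p.distinct w≢x w≢y w≢z) (cong not p.orientation)))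

  matches : Fin 6 × Fin 6 × Fin 6 → Fin 6 × Fin 6 × Fin 6 → Bool
  matches (i , j , k) (α , β , γ) = does (α ≟F i) ∧ does (β ≟F j) ∧ does (γ ≟F k)

  matches⇒≡ : ∀ v v′ → matches v v′ ≡ true → v′ ≡ v
  matches⇒≡ (i , j , k) (α , β , γ) match with α ≟F i | β ≟F j | γ ≟F k
  ... | yes refl | yes refl | yes refl = refl

  pCount-labels : ∀ i j k t → pCount R i j k t ≡ count (matches (i , j , k) ∘ labels t)
  pCount-labels i j k (x , y , z) = refl

  ∇label-injective : ∀ {α β} → ∇label α ≡ ∇label β → α ≡ β
  ∇label-injective {true}  {true}  _ = refl
  ∇label-injective {false} {false} _ = refl

  matches-∇labels : ∀ e₁ e₂ e₃ α β γ → matches (∇labels e₁ e₂ e₃) (∇labels α β γ) ≡ true →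
                    α xor (β xor γ) ≡ e₁ xor (e₂ xor e₃)
  matches-∇labels e₁ e₂ e₃ α β γ match =
    cong₂ _xor_ (∇label-injective (cong proj₁ α,β,γ≡))
      (cong₂ _xor_ (∇label-injective (cong (proj₁ ∘ proj₂) α,β,γ≡))
                   (∇label-injective (cong (proj₂ ∘ proj₂) α,β,γ≡)))
    where
    α,β,γ≡ : ∇labels α β γ ≡ ∇labels e₁ e₂ e₃
    α,β,γ≡ = matches⇒≡ (∇labels e₁ e₂ e₃) (∇labels α β γ) match

  r2≢∇label : ∀ e → r2 ≢ ∇label e
  r2≢∇label true  ()
  r2≢∇label false ()

  r3≢∇label : ∀ e → r3 ≢ ∇label e
  r3≢∇label true  ()
  r3≢∇label false ()

  pCount-cyclic-zero : ∀ e₁ e₂ e₃ s → e₁ xor (e₂ xor e₃) ≡ s → ∀ t → R t ≡ ∇label s →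
    pCount R (∇label e₁) (∇label e₂) (∇label e₃) t ≡ 0
  pCount-cyclic-zero e₁ e₂ e₃ s parity t Rt≡ = vanishes s parity t (shape-of Rt≡)
    where
    F : Fin 6 × Fin 6 × Fin 6 → Bool
    F = matches (∇labels e₁ e₂ e₃)
    unmatched : ∀ v → v ≢ ∇labels e₁ e₂ e₃ → F v ≡ false
    unmatched v v≢ = ¬-not (λ match → v≢ (matches⇒≡ (∇labels e₁ e₂ e₃) v match))
    from-profile : ∀ {s} t → Profile₃ ∇ (labels t) s (∇label s , r3 , r2) (r3 , ∇label s , r1)
                                         (r2 , r1 , ∇label s) ∇labels →
                   e₁ xor (e₂ xor e₃) ≡ s → count (F ∘ labels t) ≡ 0
    from-profile {s} _ p parity = profile₃-count-zero p F
      (unmatched (∇label s , r3 , r2) (λ eq → r3≢∇label e₂ (cong (proj₁ ∘ proj₂) eq)))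
      (unmatched (r3 , ∇label s , r1) (λ eq → r3≢∇label e₁ (cong proj₁ eq)))
      (unmatched (r2 , r1 , ∇label s) (λ eq → r2≢∇label e₁ (cong proj₁ eq)))
      (λ α β γ parity′ → ¬-not λ h → not-¬ refl (begin
        s                  ≡⟨ parity ⟨
        e₁ xor (e₂ xor e₃) ≡⟨ matches-∇labels e₁ e₂ e₃ α β γ h ⟨
        α xor (β xor γ)    ≡⟨ parity′ ⟩
        not s              ∎))
    vanishes : ∀ s → e₁ xor (e₂ xor e₃) ≡ s → ∀ t → Shape (∇label s) t →
               pCount R (∇label e₁) (∇label e₂) (∇label e₃) t ≡ 0
    vanishes true  parity t (in∇ d o)  = from-profile t (cyclic-profile d o) parity
    vanishes false parity t (out∇ d o) = from-profile t (cyclic-profile d o) parity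

  -- Intersection numbers of a regular skew two-graph

  module Regularity (k : ℕ) (regular : ∀ x y → x ≢ y → count (inNabla G x y) ≡ k) where

    regular-outside₂ : x ≢ y → count (outside (x ∷ y ∷ []) ∩ ∇ x y) ≡ k
    regular-outside₂ {x} {y} x≢y = begin
      count (outside (x ∷ y ∷ []) ∩ ∇ x y)
        ≡⟨ ∩-cong-outside (x ∷ y ∷ [])
             (λ { w (w≢x ∷ w≢y ∷ []) → sym (inNabla-distinct (x≢y , ≢-sym w≢y , ≢-sym w≢x)) }) ⟩
      count (outside (x ∷ y ∷ []) ∩ inNabla G x y)
        ≡⟨ cong₂ (λ p q → bit p + (bit q + count (outside (x ∷ y ∷ []) ∩ inNabla G x y)))
                 (inNabla-degenerate {x = x} {y} {y} (λ (_ , y≢y , _) → y≢y refl))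
                 (inNabla-degenerate {x = x} {y} {x} (λ (_ , _ , x≢x) → x≢x refl)) ⟨
      bit (inNabla G x y y) + (bit (inNabla G x y x) + count (outside (x ∷ y ∷ []) ∩ inNabla G x y))
        ≡⟨ count-remove₂ x≢y (inNabla G x y) ⟨
      count (inNabla G x y)
        ≡⟨ regular x y x≢y ⟩
      k ∎

    regular-outside₃ : Distinct x y z → k ≡ bit (∇ x y z) + count (outside (z ∷ x ∷ y ∷ []) ∩ ∇ x y)
    regular-outside₃ (x≢y , y≢z , x≢z) =
      trans (sym (regular-outside₂ x≢y)) (count-remove-outside (≢-sym x≢z ∷ ≢-sym y≢z ∷ []))

    outside-feature-counts : Distinct x y z →
      (k ≡ bit (∇ x y z) + count (outside (x ∷ y ∷ z ∷ []) ∩ ∇ y z)) ×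
      (k ≡ bit (∇ x y z) + count (outside (x ∷ y ∷ z ∷ []) ∩ ∇ z x)) ×
      (k ≡ bit (∇ x y z) + count (outside (x ∷ y ∷ z ∷ []) ∩ ∇ x y))
    outside-feature-counts {x} {y} {z} d =
      trans (regular-outside₃ (distinct-rotate d))
            (cong (λ s → bit s + count (outside (x ∷ y ∷ z ∷ []) ∩ ∇ y z)) (sym (∇-rotate d))) ,
      trans (regular-outside₃ (distinct-rotate (distinct-rotate d)))
            (cong₂ (λ s m → bit s + m)
                   (sym (trans (∇-rotate d) (∇-rotate (distinct-rotate d))))
                   (count-cong (λ w → cong (_∧ _) (sym (outside-rotate x y z w))))) ,
      trans (regular-outside₃ d)
            (cong (bit (∇ x y z) +_) (count-cong (λ w → cong (_∧ _) (outside-rotate z x y w))))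

    outside₂-count-cong : x ≢ y → x′ ≢ y′ → ∀ (F : Bool → Bool) →
      count (outside (x ∷ y ∷ []) ∩ F ∘′ ∇ x y) ≡ count (outside (x′ ∷ y′ ∷ []) ∩ F ∘′ ∇ x′ y′)
    outside₂-count-cong {x} {y} {x′} {y′} x≢y x′≢y′ =
      feature₁-count-cong (outside (x ∷ y ∷ [])) (outside (x′ ∷ y′ ∷ [])) (∇ x y) (∇ x′ y′)
        (outside-count-cong (x ∷ y ∷ []) (x′ ∷ y′ ∷ [])
          ((x≢y ∷ []) ∷ [] ∷ []) ((x′≢y′ ∷ []) ∷ [] ∷ []) refl)
        (trans (regular-outside₂ x≢y) (sym (regular-outside₂ x′≢y′)))

    outside₃-count-cong : Distinct x y z → Distinct x′ y′ z′ → ∇ x y z ≡ ∇ x′ y′ z′ →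
      ∀ (F : Bool → Bool → Bool → Bool) →
      count (outside (x ∷ y ∷ z ∷ []) ∩ λ w → F (∇ y z w) (∇ z x w) (∇ x y w)) ≡
      count (outside (x′ ∷ y′ ∷ z′ ∷ []) ∩ λ w → F (∇ y′ z′ w) (∇ z′ x′ w) (∇ x′ y′ w))
    outside₃-count-cong {x} {y} {z} {x′} {y′} {z′} d d′ s≡s′ =
      xor-feature₃-count-cong (outside (x ∷ y ∷ z ∷ [])) (outside (x′ ∷ y′ ∷ z′ ∷ []))
        (∇ y z) (∇ y′ z′) (∇ z x) (∇ z′ x′) (∇ x y) (∇ x′ y′) (not (∇ x y z))
        (parity d refl) (parity d′ (sym s≡s′))
        (outside-count-cong (x ∷ y ∷ z ∷ []) (x′ ∷ y′ ∷ z′ ∷ [])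
          (distinct⇒unique d) (distinct⇒unique d′) refl)
        (cancel (proj₁ (outside-feature-counts d)) (proj₁ (outside-feature-counts d′)))
        (cancel (proj₁ (proj₂ (outside-feature-counts d))) (proj₁ (proj₂ (outside-feature-counts d′))))
        (cancel (proj₂ (proj₂ (outside-feature-counts d))) (proj₂ (proj₂ (outside-feature-counts d′))))
      where
      parity : ∀ {x y z s} → Distinct x y z → ∇ x y z ≡ s → ∀ w → outside (x ∷ y ∷ z ∷ []) w ≡ true →
               ∇ x y w ≡ (∇ y z w xor ∇ z x w) xor not s
      parity {x} {y} {z} d orientation w out with outside⁻ {xs = x ∷ y ∷ z ∷ []} {v = w} out
      ... | w≢x ∷ w≢y ∷ w≢z ∷ [] = xor-solve (∇ y z w) (∇ z x w) (∇ x y w)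
                                     (trans (∇-parity d w≢x w≢y w≢z) (cong not orientation))
      cancel : ∀ {m m′} → k ≡ bit (∇ x y z) + m → k ≡ bit (∇ x′ y′ z′) + m′ → m ≡ m′
      cancel {m} {m′} k≡ k≡′ = +-cancelˡ-≡ (bit (∇ x y z)) m m′
        (trans (sym k≡) (trans k≡′ (cong (λ s → bit s + m′) (sym s≡s′))))

    profile₂-count : ∀ {A : Set} {τ τ′ : Fin n → A} {a₁ a₂ g} →
      Profile₂ ∇ τ a₁ a₂ g → Profile₂ ∇ τ′ a₁ a₂ g → ∀ (F : A → Bool) → count (F ∘ τ) ≡ count (F ∘ τ′)
    profile₂-count {τ = τ} {τ′} {g = g} p p′ F =
      count-cong-outside (p.x ∷ p.y ∷ []) (p′.x ∷ p′.y ∷ [])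
        ((p.x≢y ∷ []) ∷ [] ∷ []) ((p′.x≢y ∷ []) ∷ [] ∷ [])
        (cong F (trans p.at-x (sym p′.at-x)) ∷ cong F (trans p.at-y (sym p′.at-y)) ∷ []) (begin
        count (outside (p.x ∷ p.y ∷ []) ∩ F ∘ τ)
          ≡⟨ ∩-cong-outside (p.x ∷ p.y ∷ []) (λ { w (w≢x ∷ w≢y ∷ []) → cong F (p.off w w≢x w≢y) }) ⟩
        count (outside (p.x ∷ p.y ∷ []) ∩ (F ∘ g) ∘′ ∇ p.x p.y)
          ≡⟨ outside₂-count-cong p.x≢y p′.x≢y (F ∘ g) ⟩
        count (outside (p′.x ∷ p′.y ∷ []) ∩ (F ∘ g) ∘′ ∇ p′.x p′.y)
          ≡⟨ ∩-cong-outside (p′.x ∷ p′.y ∷ []) (λ { w (w≢x ∷ w≢y ∷ []) → cong F (p′.off w w≢x w≢y) }) ⟨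
        count (outside (p′.x ∷ p′.y ∷ []) ∩ F ∘ τ′) ∎)
      where
      module p  = Profile₂ p
      module p′ = Profile₂ p′

    profile₃-count : ∀ {A : Set} {τ τ′ : Fin n → A} {s a₁ a₂ a₃ g} →
      Profile₃ ∇ τ s a₁ a₂ a₃ g → Profile₃ ∇ τ′ s a₁ a₂ a₃ g →
      ∀ (F : A → Bool) → count (F ∘ τ) ≡ count (F ∘ τ′)
    profile₃-count {τ = τ} {τ′} {g = g} p p′ F =
      count-cong-outside (p.x ∷ p.y ∷ p.z ∷ []) (p′.x ∷ p′.y ∷ p′.z ∷ [])
        (distinct⇒unique p.distinct) (distinct⇒unique p′.distinct)
        (cong F (trans p.at-x (sym p′.at-x)) ∷ cong F (trans p.at-y (sym p′.at-y)) ∷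
         cong F (trans p.at-z (sym p′.at-z)) ∷ []) (begin
        count (outside (p.x ∷ p.y ∷ p.z ∷ []) ∩ F ∘ τ)
          ≡⟨ ∩-cong-outside (p.x ∷ p.y ∷ p.z ∷ [])
               (λ { w (w≢x ∷ w≢y ∷ w≢z ∷ []) → cong F (p.off w w≢x w≢y w≢z) }) ⟩
        count (outside (p.x ∷ p.y ∷ p.z ∷ []) ∩ λ w → F (g (∇ p.y p.z w) (∇ p.z p.x w) (∇ p.x p.y w)))
          ≡⟨ outside₃-count-cong p.distinct p′.distinct (trans p.orientation (sym p′.orientation))
               (λ α β γ → F (g α β γ)) ⟩
        count (outside (p′.x ∷ p′.y ∷ p′.z ∷ []) ∩
               λ w → F (g (∇ p′.y p′.z w) (∇ p′.z p′.x w) (∇ p′.x p′.y w)))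
          ≡⟨ ∩-cong-outside (p′.x ∷ p′.y ∷ p′.z ∷ [])
               (λ { w (w≢x ∷ w≢y ∷ w≢z ∷ []) → cong F (p′.off w w≢x w≢y w≢z) }) ⟨
        count (outside (p′.x ∷ p′.y ∷ p′.z ∷ []) ∩ F ∘ τ′) ∎)
      where
      module p  = Profile₃ p
      module p′ = Profile₃ p′

    labels-count-invariant : ∀ {t t′} → Shape l t → Shape l t′ →
      ∀ F → count (F ∘ labels t) ≡ count (F ∘ labels t′)
    labels-count-invariant (xxx x)    (xxx x′)     = profile₁-count (xxx-profile x) (xxx-profile x′)
    labels-count-invariant (xyy x≢y)  (xyy x′≢y′)  = profile₂-count (xyy-profile x≢y) (xyy-profile x′≢y′)
    labels-count-invariant (xyx x≢y)  (xyx x′≢y′)  = profile₂-count (xyx-profile x≢y) (xyx-profile x′≢y′)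
    labels-count-invariant (xxy x≢y)  (xxy x′≢y′)  = profile₂-count (xxy-profile x≢y) (xxy-profile x′≢y′)
    labels-count-invariant (in∇ d o)  (in∇ d′ o′)  =
      profile₃-count (cyclic-profile d o) (cyclic-profile d′ o′)
    labels-count-invariant (out∇ d o) (out∇ d′ o′) =
      profile₃-count (cyclic-profile d o) (cyclic-profile d′ o′)

    pCount-invariant : ∀ i j k {t t′} → R t ≡ R t′ → pCount R i j k t ≡ pCount R i j k t′
    pCount-invariant i j k {t} {t′} Rt≡Rt′ = begin
      pCount R i j k t
        ≡⟨ pCount-labels i j k t ⟩
      count (matches (i , j , k) ∘ labels t)
        ≡⟨ labels-count-invariant (shape t) (shape-of {t = t′} (sym Rt≡Rt′)) (matches (i , j , k)) ⟩
      count (matches (i , j , k) ∘ labels t′)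
        ≡⟨ pCount-labels i j k t′ ⟨
      pCount R i j k t′ ∎

    intersection-numbers-constant : ∀ i j k l → Σ ℕ λ p → ∀ t → R t ≡ l → pCount R i j k t ≡ p
    intersection-numbers-constant i j k l = constant-on-relation R (pCount R i j k) l
      (λ {t} {t′} Rt≡l Rt′≡l → pCount-invariant i j k {t} {t′} (trans Rt≡l (sym Rt′≡l)))

    column-count : Fin 6 → Triple n → ℕ
    column-count i (_ , y , z) = count (λ x → isLabel R i (x , y , z))

    column-count-invariant : ∀ i {t t′} → Shape r3 t → Shape r3 t′ → column-count i t ≡ column-count i t′
    column-count-invariant i (xxy y≢z) (xxy y′≢z′) =
      profile₂-count (column-profile y≢z) (column-profile y′≢z′) (λ l → does (l ≟F i))

    -- The pairs y ≢ z are exactly the triples (y , y , z) of R₃.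
    column-counts-constant : ∀ i → Σ ℕ λ a → ∀ y z → y ≢ z → count (λ x → isLabel R i (x , y , z)) ≡ a
    column-counts-constant i with constant-on-relation R (column-count i) r3
      (λ {t} {t′} Rt≡r3 Rt′≡r3 →
         column-count-invariant i (shape-of {t = t} Rt≡r3) (shape-of {t = t′} Rt′≡r3))
    ... | a , column≡a = a , λ y z y≢z → column≡a (y , y , z) (shape-label (xxy y≢z))

    isSkewSymmetricAST : IsSkewSymmetricAST n R
    isSkewSymmetricAST = record
      { isAST = record
        { I0  = R≡r0⇔
        ; I1  = R≡r1⇔
        ; I2  = R≡r2⇔
        ; I3  = R≡r3⇔
        ; II  = λ i π → relabel (permutation-covariant π) ⟨$⟩ʳ i ,
                        image-covariant (π ⟨$⟩ʳ_) (permutation-covariant π) (act-surjective π) i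
        ; III = column-counts-constant
        ; IV  = intersection-numbers-constant
        }
      ; SS1-4 = rotate-image r4
      ; SS1-5 = rotate-image r5
      ; SS2-4 = λ u → swap-disjoint r4 u λ ()
      ; SS2-5 = λ u → swap-disjoint r5 u λ ()
      }

theorem3p2 : ∀ (n : ℕ) (G : SkewTwoGraph n) → Regular G →
    IsSkewSymmetricAST n (schemeOf G)
    × (∀ t → schemeOf G t ≡ r4 → pCount (schemeOf G) r4 r4 r4 t ≡ 0)
    × (∀ t → schemeOf G t ≡ r5 → pCount (schemeOf G) r4 r4 r5 t ≡ 0)
    × (∀ t → schemeOf G t ≡ r4 → pCount (schemeOf G) r4 r5 r5 t ≡ 0)
    × (∀ t → schemeOf G t ≡ r5 → pCount (schemeOf G) r5 r5 r5 t ≡ 0)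
theorem3p2 n G (k , regular) =
  isSkewSymmetricAST ,
  pCount-cyclic-zero true  true  true  true  refl ,
  pCount-cyclic-zero true  true  false false refl ,
  pCount-cyclic-zero true  false false true  refl ,
  pCount-cyclic-zero false false false false refl
  where
  open SkewTwoGraphScheme G
  open Regularity k regular
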